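{- Let $n\geq k\geq 1$, let $S\neq T$ be $k$-subsets of $[n]$, and let $C$ be a non-trivial component of $h(S,T)$. Then at least one of the following holds: the vertex $x_{min}(C)$ has degree one in $h(S,T)$; the vertex $y_{max}(C)$ has degree one in $h(S,T)$; the pair $(x_{min}(C),y_{max}(C))$ belongs to both $f(S)$ and $f(T)$.
   Context: $[m]=\{1,\dots,m\}$. For a $k$-subset $S$ of $[n]$ define $f(S)\subseteq([n]\setminus[k])\times[k]$: if $S=[k]$ then $f(S)=\emptyset$; otherwise let $S\setminus[k]=\{x_1,\dots,x_t\}$ with $n\geq x_1>\dots>x_t\geq k+1$ and $[k]\setminus S=\{y_1,\dots,y_t\}$ with $1\leq y_1<\dots<y_t\leq k$, and set $f(S)=\{(x_1,y_1),\dots,(x_t,y_t)\}$. Let $h(S)$ be the graph on $[n]$ whose edges are the pairs $\{x,y\}$ with $(x,y)\in f(S)$, and $h(S,T)$ the multigraph union of $h(S)$ and $h(T)$ (pairs in $f(S)\cap f(T)$ give double edges; degrees count multiplicity). A non-trivial component is a connected component with at least one edge. For such $C$ (viewed as its vertex set): $x_{max}(C)=\max(C\cap([n]\setminus[k]))$, $x_{min}(C)=\min(C\cap([n]\setminus[k]))$, $y_{max}(C)=\max(C\cap[k])$, $y_{min}(C)=\min(C\cap[k])$. -}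

module Defs where

open import Data.Nat using (ℕ; suc; _<_; _≤_; _<?_; _≟_)
open import Data.Fin using (Fin; toℕ)
open import Data.Fin.Subset using (Subset)
import Data.Fin.Subset.Properties as SubP
open import Data.List using (List; map; filter; reverse; zip; upTo; allFin; _++_; length)
open import Data.List.Relation.Unary.Any using (Any)
import Data.List.Membership.DecPropositional as DecMem
open import Data.Product using (_×_; _,_; proj₁; proj₂)
open import Data.Sum using (_⊎_)
open import Relation.Nullary using (¬?)
open import Relation.Binary.PropositionalEquality using (_≡_)
open import Relation.Binary.Construct.Closure.ReflexiveTransitive using (Star)

open DecMem _≟_ using () renaming (_∈?_ to _∈ℕ?_)

oneTo : ℕ → List ℕ
oneTo m = map suc (upTo m)

-- A subset S of [n] is a `Subset n`; Fin index i stands for the number i+1.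
-- elems S lists the elements of S (as numbers in [n]) in increasing order.
elems : ∀ {n} → Subset n → List ℕ
elems {n} S = map (λ i → suc (toℕ i)) (filter (SubP._∈? S) (allFin n))

xsOf : ∀ {n} → ℕ → Subset n → List ℕ
xsOf k S = reverse (filter (k <?_) (elems S))

ysOf : ∀ {n} → ℕ → Subset n → List ℕ
ysOf k S = filter (λ y → ¬? (y ∈ℕ? elems S)) (oneTo k)

f : ∀ {n} → ℕ → Subset n → List (ℕ × ℕ)
f k S = zip (xsOf k S) (ysOf k S)

-- edge multiset of h(S,T): edges of h(S) followed by edges of h(T)
edgesST : ∀ {n} → ℕ → Subset n → Subset n → List (ℕ × ℕ)
edgesST k S T = f k S ++ f k T

Incident : ℕ → ℕ × ℕ → Set
Incident v (x , y) = (x ≡ v) ⊎ (y ≡ v)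

incident? : ∀ v (e : ℕ × ℕ) → Relation.Nullary.Dec (Incident v e)
incident? v (x , y) = Relation.Nullary.Decidable._⊎-dec_ (x ≟ v) (y ≟ v)
  where import Relation.Nullary.Decidable

-- degree of v in h(S,T), counting multiplicity
deg : ∀ {n} → ℕ → Subset n → Subset n → ℕ → ℕ
deg k S T v = length (filter (incident? v) (edgesST k S T))

Adj : ∀ {n} → ℕ → Subset n → Subset n → ℕ → ℕ → Set
Adj k S T u v = Any (λ e → (proj₁ e ≡ u × proj₂ e ≡ v) ⊎ (proj₁ e ≡ v × proj₂ e ≡ u)) (edgesST k S T)

Connected : ∀ {n} → ℕ → Subset n → Subset n → ℕ → ℕ → Set
Connected k S T = Star (Adj k S T)

-- C is the vertex set of the (non-trivial) component of h(S,T) containing v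
InComp : ∀ {n} → ℕ → Subset n → Subset n → ℕ → ℕ → Set
InComp k S T v u = Connected k S T v u

IsXmin : ∀ {n} → ℕ → Subset n → Subset n → ℕ → ℕ → Set
IsXmin k S T v xm = InComp k S T v xm × k < xm ×
  (∀ u → InComp k S T v u → k < u → xm ≤ u)

IsYmax : ∀ {n} → ℕ → Subset n → Subset n → ℕ → ℕ → Set
IsYmax k S T v ym = InComp k S T v ym × 1 ≤ ym × ym ≤ k ×
  (∀ u → InComp k S T v u → 1 ≤ u → u ≤ k → u ≤ ym)

-- Each f(X) is a matching whose first components, read as x₁ > x₂ > ⋯, lie above k and whose
-- second components, read as y₁ < y₂ < ⋯, lie in [k]; so it is antitone: a larger x is paired
-- with a smaller y. The degree in h(S,T) is the sum of the degrees in the two matchings, so a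
-- vertex of C that is not a leaf is covered by both f(S) and f(T). If x_min and y_max are both
-- covered by f(X), then x_min is paired with some b ∈ C, so b ≤ y_max, and y_max with some
-- c ∈ C, so x_min ≤ c; were x_min < c, antitonicity would give y_max < b. Hence c = x_min.
module Submission where

open import Defs
open import Data.Nat using (ℕ; _≤_)
open import Data.Fin.Subset using (Subset; ∣_∣)
open import Data.List.Membership.Propositional using (_∈_)
open import Data.Product using (_×_; _,_)
open import Data.Sum using (_⊎_)
open import Relation.Binary.PropositionalEquality using (_≡_)
open import Relation.Nullary using (¬_)

open import Function using (id; flip)
open import Data.Empty using (⊥-elim)
open import Data.Nat using (suc; _<_; _>_; _+_; _<?_; z≤n; s≤s; s<s)
open import Data.Nat.Properties
  using (≤-antisym; ≤-reflexive; ≤-trans; +-mono-≤; <-irrefl; <-asym; <⇒≢; >⇒≢; <⇒≱; m≤n⇒m<n∨m≡n)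
open import Data.Product using (proj₁; proj₂; ∃-syntax)
open import Data.Sum using (inj₁; inj₂)
import Data.Sum as Sum
import Data.Product as Product
open import Data.List using (List; []; _∷_; filter; reverse; zip; length; _++_)
open import Data.List.Properties using (unfold-reverse; filter-++; filter-none; filter-accept; filter-reject; length-++)
open import Data.List.Relation.Unary.Any using (Any; here; there; any?)
import Data.List.Relation.Unary.Any as Any
import Data.List.Relation.Unary.Any.Properties as AnyP
open import Data.List.Relation.Unary.All using (All; []; _∷_)
import Data.List.Relation.Unary.All as All
import Data.List.Relation.Unary.All.Properties as AllP
open import Data.List.Relation.Unary.AllPairs using (AllPairs; []; _∷_)
import Data.List.Relation.Unary.AllPairs as AllPairs
import Data.List.Relation.Unary.AllPairs.Properties as AllPairsP
open import Data.List.Relation.Unary.Unique.Propositional using (Unique)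
open import Data.List.Relation.Binary.Disjoint.Propositional using (Disjoint)
open import Data.List.Membership.Propositional using (find)
open import Data.List.Membership.Propositional.Properties
  using (∈-filter⁺; ∈-filter⁻; ∈-map⁻; ∈-length; ∈-++⁺ˡ; ∈-++⁺ʳ)
open import Relation.Nullary using (yes; no)
open import Relation.Binary.PropositionalEquality using (refl; trans; cong)
open import Relation.Binary.Construct.Closure.ReflexiveTransitive using (ε; _◅_; _◅◅_)
import Data.Fin.Subset.Properties as SubsetP

All-reverse : ∀ {A : Set} {P : A → Set} {xs} → All P xs → All P (reverse xs)
All-reverse p = All.tabulate (λ x∈ → All.lookup p (AnyP.reverse⁻ x∈))

AllPairs-reverse : ∀ {A : Set} {R : A → A → Set} {xs} → AllPairs R xs → AllPairs (flip R) (reverse xs)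
AllPairs-reverse [] = []
AllPairs-reverse {xs = x ∷ xs} (x~xs ∷ xs!) rewrite unfold-reverse x xs =
  AllPairsP.++⁺ (AllPairs-reverse xs!) ([] ∷ []) (All.map (_∷ []) (All-reverse x~xs))

∈-zip⁻ : ∀ {A B : Set} {a : A} {b : B} {xs ys} → (a , b) ∈ zip xs ys → a ∈ xs × b ∈ ys
∈-zip⁻ {xs = _ ∷ _} {_ ∷ _} (here refl) = here refl , here refl
∈-zip⁻ {xs = _ ∷ _} {_ ∷ _} (there ab∈) = Product.map there there (∈-zip⁻ ab∈)

incidences : ℕ → List (ℕ × ℕ) → ℕ
incidences w E = length (filter (incident? w) E)

incidences-++ : ∀ w E F → incidences w (E ++ F) ≡ incidences w E + incidences w F
incidences-++ w E F = trans (cong length (filter-++ (incident? w) E F)) (length-++ (filter (incident? w) E))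

incidences-none : ∀ {w} E → ¬ Any (Incident w) E → incidences w E ≡ 0
incidences-none {w} E ¬w∼E = cong length (filter-none (incident? w) (AllP.¬Any⇒All¬ E ¬w∼E))

incidences-pos : ∀ {w E} → Any (Incident w) E → 0 < incidences w E
incidences-pos {w} w∼E with find w∼E
... | _ , e∈E , w∼e = ∈-length (∈-filter⁺ (incident? w) e∈E w∼e)

Incident⇒¬Incident-zip : ∀ {w x y xs ys} → Unique (x ∷ xs) → Unique (y ∷ ys) → Disjoint (x ∷ xs) (y ∷ ys) →
  Incident w (x , y) → ¬ Any (Incident w) (zip xs ys)
Incident⇒¬Incident-zip (x∉xs ∷ _) (y∉ys ∷ _) disjoint w∼xy w∼zip with find w∼zip
... | (c , d) , cd∈ , w∼cd with ∈-zip⁻ cd∈ | w∼xy | w∼cd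
...   | c∈ , _  | inj₁ refl | inj₁ refl = All.lookup x∉xs c∈ refl
...   | _  , d∈ | inj₁ refl | inj₂ refl = disjoint (here refl , there d∈)
...   | c∈ , _  | inj₂ refl | inj₁ refl = disjoint (there c∈ , here refl)
...   | _  , d∈ | inj₂ refl | inj₂ refl = All.lookup y∉ys d∈ refl

incidences-zip≤1 : ∀ w {xs ys} → Unique xs → Unique ys → Disjoint xs ys → incidences w (zip xs ys) ≤ 1
incidences-zip≤1 w {[]} _ _ _ = z≤n
incidences-zip≤1 w {_ ∷ _} {[]} _ _ _ = z≤n
incidences-zip≤1 w {x ∷ xs} {y ∷ ys} ux@(_ ∷ uxs) uy@(_ ∷ uys) disjoint with incident? w (x , y)
... | yes w∼xy rewrite filter-accept (incident? w) {x , y} {zip xs ys} w∼xy = s≤s (≤-reflexive (incidences-none (zip xs ys) (Incident⇒¬Incident-zip ux uy disjoint w∼xy)))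
... | no ¬w∼xy rewrite filter-reject (incident? w) {x , y} {zip xs ys} ¬w∼xy = incidences-zip≤1 w uxs uys (λ (a∈ , b∈) → disjoint (there a∈ , there b∈))

zip-antitone : ∀ {xs ys} → AllPairs _>_ xs → AllPairs _<_ ys →
  ∀ {a b c d} → (a , b) ∈ zip xs ys → (c , d) ∈ zip xs ys → a < c → d < b
zip-antitone {_ ∷ _} {_ ∷ _} _ _ (here refl) (here refl) a<c = ⊥-elim (<-irrefl refl a<c)
zip-antitone {_ ∷ xs} {_ ∷ ys} (x>xs ∷ _) _ (here refl) (there cd∈) a<c =
  ⊥-elim (<-asym a<c (All.lookup x>xs (proj₁ (∈-zip⁻ cd∈))))
zip-antitone {_ ∷ xs} {_ ∷ ys} _ (y<ys ∷ _) (there ab∈) (here refl) _ = All.lookup y<ys (proj₂ (∈-zip⁻ ab∈))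
zip-antitone {_ ∷ _} {_ ∷ _} (_ ∷ xs!) (_ ∷ ys!) (there ab∈) (there cd∈) a<c = zip-antitone xs! ys! ab∈ cd∈ a<c

elems-increasing : ∀ {n} (X : Subset n) → AllPairs _<_ (elems X)
elems-increasing X = AllPairsP.map⁺ (AllPairsP.filter⁺ (SubsetP._∈? X) (AllPairsP.tabulate⁺-< s<s))

module _ {n} (k : ℕ) (X : Subset n) where

  xsOf-decreasing : AllPairs _>_ (xsOf k X)
  xsOf-decreasing = AllPairs-reverse (AllPairsP.filter⁺ (k <?_) (elems-increasing X))

  ysOf-increasing : AllPairs _<_ (ysOf k X)
  ysOf-increasing = AllPairsP.filter⁺ _ (AllPairsP.map⁺ (AllPairsP.applyUpTo⁺₁ id k (λ i<j _ → s<s i<j)))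

  ∈-xsOf⁻ : ∀ {a} → a ∈ xsOf k X → k < a
  ∈-xsOf⁻ a∈ = proj₂ (∈-filter⁻ (k <?_) {xs = elems X} (AnyP.reverse⁻ {xs = filter (k <?_) (elems X)} a∈))

  ∈-ysOf⁻ : ∀ {b} → b ∈ ysOf k X → 1 ≤ b × b ≤ k
  ∈-ysOf⁻ b∈ with ∈-map⁻ suc (proj₁ (∈-filter⁻ _ {xs = oneTo k} b∈))
  ... | _ , i∈ , refl = s≤s z≤n , All.lookup (AllP.all-upTo k) i∈

  ∈-f⁻ : ∀ {a b} → (a , b) ∈ f k X → k < a × 1 ≤ b × b ≤ k
  ∈-f⁻ ab∈ = Product.map ∈-xsOf⁻ ∈-ysOf⁻ (∈-zip⁻ ab∈)

  incidences-f≤1 : ∀ w → incidences w (f k X) ≤ 1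
  incidences-f≤1 w = incidences-zip≤1 w
    (AllPairs.map >⇒≢ xsOf-decreasing) (AllPairs.map <⇒≢ ysOf-increasing)
    (λ (a∈xs , a∈ys) → <⇒≱ (∈-xsOf⁻ a∈xs) (proj₂ (∈-ysOf⁻ a∈ys)))

  f-antitone : ∀ {a b c d} → (a , b) ∈ f k X → (c , d) ∈ f k X → a < c → d < b
  f-antitone = zip-antitone xsOf-decreasing ysOf-increasing

  Incident-f-above : ∀ {w} → k < w → Any (Incident w) (f k X) → ∃[ b ] (w , b) ∈ f k X
  Incident-f-above k<w w∼f with find w∼f
  ... | (_ , b) , ab∈ , inj₁ refl = b , ab∈
  ... | _ , ab∈ , inj₂ refl = ⊥-elim (<⇒≱ k<w (proj₂ (proj₂ (∈-f⁻ ab∈))))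

  Incident-f-below : ∀ {w} → w ≤ k → Any (Incident w) (f k X) → ∃[ a ] (a , w) ∈ f k X
  Incident-f-below w≤k w∼f with find w∼f
  ... | _ , ab∈ , inj₁ refl = ⊥-elim (<⇒≱ (proj₁ (∈-f⁻ ab∈)) w≤k)
  ... | (a , _) , ab∈ , inj₂ refl = a , ab∈

module _ {n} (k : ℕ) (S T : Subset n) where

  ∈edges⇒Adj : ∀ {a b} → (a , b) ∈ edgesST k S T → Adj k S T a b
  ∈edges⇒Adj = Any.map (λ { refl → inj₁ (refl , refl) })

  Adj-sym : ∀ {u w} → Adj k S T u w → Adj k S T w u
  Adj-sym = Any.map Sum.swap

  Adj⇒deg-pos : ∀ {u w} → Adj k S T u w → 0 < deg k S T w
  Adj⇒deg-pos u∼w = incidences-pos (Any.map endpoint u∼w)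
    where
    endpoint : ∀ {u w} {e : ℕ × ℕ} → (proj₁ e ≡ u × proj₂ e ≡ w) ⊎ (proj₁ e ≡ w × proj₂ e ≡ u) → Incident w e
    endpoint (inj₁ (_ , refl)) = inj₂ refl
    endpoint (inj₂ (refl , _)) = inj₁ refl

  Connected⇒deg-pos : ∀ {u w} → Connected k S T u w → 0 < deg k S T u → 0 < deg k S T w
  Connected⇒deg-pos ε pos = pos
  Connected⇒deg-pos (u∼u′ ◅ u′⋯w) _ = Connected⇒deg-pos u′⋯w (Adj⇒deg-pos u∼u′)

  deg-split : ∀ w → deg k S T w ≡ incidences w (f k S) + incidences w (f k T)
  deg-split w = incidences-++ w (f k S) (f k T)

  deg≡1⊎Incident-both : ∀ {w} → 0 < deg k S T w →
    deg k S T w ≡ 1 ⊎ (Any (Incident w) (f k S) × Any (Incident w) (f k T))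
  deg≡1⊎Incident-both {w} pos with any? (incident? w) (f k S) | any? (incident? w) (f k T)
  ... | yes w∼S | yes w∼T = inj₂ (w∼S , w∼T)
  ... | no ¬w∼S | _ = inj₁ (≤-antisym (≤-trans (≤-reflexive (deg-split w))
          (+-mono-≤ (≤-reflexive (incidences-none (f k S) ¬w∼S)) (incidences-f≤1 k T w))) pos)
  ... | yes _ | no ¬w∼T = inj₁ (≤-antisym (≤-trans (≤-reflexive (deg-split w))
          (+-mono-≤ (incidences-f≤1 k S w) (≤-reflexive (incidences-none (f k T) ¬w∼T)))) pos)

  xmin-ymax∈f : ∀ {v xm ym} (X : Subset n) → (∀ {e} → e ∈ f k X → e ∈ edgesST k S T) →
    IsXmin k S T v xm → IsYmax k S T v ym →
    Any (Incident xm) (f k X) → Any (Incident ym) (f k X) → (xm , ym) ∈ f k X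
  xmin-ymax∈f {v} {xm} {ym} X f⊆edges (v⋯xm , k<xm , xm-least) (v⋯ym , _ , ym≤k , ym-greatest) xm∼f ym∼f
    with Incident-f-above k X k<xm xm∼f | Incident-f-below k X ym≤k ym∼f
  ... | b , xm-b | c , c-ym = xm≡c (m≤n⇒m<n∨m≡n xm≤c)
    where
    b≤ym : b ≤ ym
    b≤ym = ym-greatest b (v⋯xm ◅◅ ∈edges⇒Adj (f⊆edges xm-b) ◅ ε)
      (proj₁ (proj₂ (∈-f⁻ k X xm-b))) (proj₂ (proj₂ (∈-f⁻ k X xm-b)))

    xm≤c : xm ≤ c
    xm≤c = xm-least c (v⋯ym ◅◅ Adj-sym (∈edges⇒Adj (f⊆edges c-ym)) ◅ ε) (proj₁ (∈-f⁻ k X c-ym))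

    xm≡c : xm < c ⊎ xm ≡ c → (xm , ym) ∈ f k X
    xm≡c (inj₁ xm<c) = ⊥-elim (<⇒≱ (f-antitone k X xm-b c-ym xm<c) b≤ym)
    xm≡c (inj₂ refl) = c-ym

mainTheorem5 : (n k : ℕ) → 1 ≤ k → k ≤ n →
    (S T : Subset n) → ∣ S ∣ ≡ k → ∣ T ∣ ≡ k → ¬ (S ≡ T) →
    (v : ℕ) → 1 ≤ deg k S T v →
    (xm ym : ℕ) → IsXmin k S T v xm → IsYmax k S T v ym →
    (deg k S T xm ≡ 1) ⊎ (deg k S T ym ≡ 1) ⊎ (((xm , ym) ∈ f k S) × ((xm , ym) ∈ f k T))
mainTheorem5 n k _ _ S T _ _ _ v deg-v xm ym xm-min ym-max
  with deg≡1⊎Incident-both k S T (Connected⇒deg-pos k S T (proj₁ xm-min) deg-v)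
     | deg≡1⊎Incident-both k S T (Connected⇒deg-pos k S T (proj₁ ym-max) deg-v)
... | inj₁ xm-leaf | _ = inj₁ xm-leaf
... | inj₂ _ | inj₁ ym-leaf = inj₂ (inj₁ ym-leaf)
... | inj₂ (xm∼S , xm∼T) | inj₂ (ym∼S , ym∼T) = inj₂ (inj₂
  ( xmin-ymax∈f k S T S ∈-++⁺ˡ xm-min ym-max xm∼S ym∼S
  , xmin-ymax∈f k S T T (∈-++⁺ʳ (f k S)) xm-min ym-max xm∼T ym∼T))
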